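{- Let $r,k,t$ be positive integers with $t\le r$, and let $\mathcal H$ be an $r$-uniform $r$-partite $k$-wise $t$-intersecting hypergraph. If $k\ge 3$ and $t\ge 1$, or $k=2$ and $t>\frac r3$, then \[ \tau(\mathcal H)\le \left\lfloor \frac{r-t}{k}\right\rfloor + 1, \] and this bound is best possible: for such $r,k,t$ there exists an $r$-uniform $r$-partite $k$-wise $t$-intersecting hypergraph $\mathcal H$ with $\tau(\mathcal H)=\lfloor (r-t)/k\rfloor+1$.
   Context: All hypergraphs are finite. An $r$-uniform hypergraph $\mathcal H$ is $r$-partite if its vertex set can be partitioned as $V(\mathcal H)=P_1\sqcup\dots\sqcup P_r$ such that $|e\cap P_j|=1$ for every edge $e$ and every $j\in[r]$. A hypergraph is $k$-wise $t$-intersecting if for any edges $e_1,\dots,e_k\in E(\mathcal H)$ we have $|e_1\cap\dots\cap e_k|\ge t$. A cover of $\mathcal H$ is a set $C\subseteq V(\mathcal H)$ with $C\cap e\neq\emptyset$ for every edge $e$; the cover number $\tau(\mathcal H)$ is the minimum size of a cover. -}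

module Defs where

open import Data.Nat using (ℕ; _≤_; _≥_; _<_; _*_; zero; suc)
open import Data.Nat.DivMod using (_/_)
open import Data.Fin using (Fin; _≟_)
open import Relation.Nullary.Decidable using (isYes)
open import Data.Fin.Subset using (Subset; _∩_; ⋂; ∣_∣; ⊤; Nonempty; _∈_)
open import Data.List using (List)
import Data.List.Membership.Propositional as LM
open import Data.Product using (Σ; _×_; _,_)
open import Data.Vec using (tabulate)
open import Relation.Binary.PropositionalEquality using (_≡_)

record Hypergraph : Set where
  constructor mkHG
  field
    n     : ℕ
    edges : List (Subset n)
open Hypergraph public

IsEdge : (H : Hypergraph) → Subset (n H) → Set
IsEdge H e = e LM.∈ edges H

Uniform : ℕ → Hypergraph → Set
Uniform r H = ∀ e → IsEdge H e → ∣ e ∣ ≡ r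

PartOf : {m r : ℕ} → (Fin m → Fin r) → Fin r → Subset m
PartOf part j = tabulate (λ v → isYes (part v ≟ j))

Partite : ℕ → Hypergraph → Set
Partite r H = Σ (Fin (n H) → Fin r) λ part →
  ∀ e → IsEdge H e → ∀ (j : Fin r) → ∣ e ∩ PartOf part j ∣ ≡ 1

-- k-wise t-intersecting: any k edges (repetitions allowed) share ≥ t vertices
KWiseIntersecting : ℕ → ℕ → Hypergraph → Set
KWiseIntersecting k t H = ∀ (es : Fin k → Subset (n H)) → (∀ i → IsEdge H (es i)) →
  ∣ ⋂ (Data.List.tabulate es) ∣ ≥ t
  where import Data.List

IsCover : (H : Hypergraph) → Subset (n H) → Set
IsCover H C = ∀ e → IsEdge H e → Nonempty (C ∩ e)

CoverNumber≤ : Hypergraph → ℕ → Set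
CoverNumber≤ H m = Σ (Subset (n H)) λ C → IsCover H C × ∣ C ∣ ≤ m

CoverNumber≡ : Hypergraph → ℕ → Set
CoverNumber≡ H m = (Σ (Subset (n H)) λ C → IsCover H C × ∣ C ∣ ≡ m)
                 × (∀ C → IsCover H C → m ≤ ∣ C ∣)

module Submission where

-- Let m = ⌊(r - t)/k⌋.  Upper bound τ(H) ≤ m + 1: call a tuple of p ≥ 2
-- edges stable if exchanging one of them for another edge never shrinks its
-- core ⋂ es (repeated exchanging reaches one).  If an edge f avoids X ⊆ core,
-- exchanging any es i for f gains ≥ |X| vertices, and the core with all gained
-- vertices meets each part at most once, so |core| + p|X| ≤ r (exchange
-- lemma); hence X ⊆ core with r < |core| + p|X| is a cover.  Take p = 2 when
-- k = 2, 3t > r; for k ≥ 3 take p = k - 1, where a small core is covered by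
-- any |core| + 1 - t of its vertices, as every edge meets it in ≥ t vertices.
-- Sharpness: parts j < r with vertices of colours 0..m, edges the graphs of
-- colourings with ≤ m nonzero colours; k of them share colour 0 on ≥ r - km ≥ t
-- parts, and every set of ≤ m vertices is avoided by one of them.

open import Defs
open import Data.Nat using (ℕ; _≤_; _<_; _*_; _∸_; _+_; _/_; NonZero)
open import Data.Product using (Σ; _×_)
open import Data.Sum using (_⊎_)
open import Relation.Binary.PropositionalEquality using (_≡_)

open import Data.Nat using (zero; suc; z≤n; s≤s; _≤?_; _<?_; _%_)
open import Data.Nat.Properties
  using ( +-0-commutativeMonoid; +-comm; +-assoc; +-suc; *-comm; *-identityʳ
        ; ≤-refl; ≤-reflexive; ≤-trans; ≤-antisym; ≤-pred; module ≤-Reasoning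
        ; +-mono-≤; +-monoˡ-≤; +-monoʳ-≤; +-monoʳ-<; +-monoˡ-<; +-cancelˡ-≤; +-cancelʳ-≤
        ; m≤m+n; m≤n+m; n≤1+n; <⇒≱; ≮⇒≥; ≰⇒>; 1+n≰n
        ; ∸-monoˡ-≤; ∸-monoʳ-≤; ∸-monoˡ-<; m+[n∸m]≡n; m+n∸m≡n )
open import Data.Nat.DivMod using (m≡m%n+[m/n]*n; m%n<n; m/n*n≤m; m<n*o⇒m/o<n)
open import Data.Nat.Induction using (<-wellFounded)
open import Induction.WellFounded using (Acc; acc)
open import Data.Bool using (Bool; true; false; _∧_; _∨_; not)
import Data.Bool as Bool
open import Data.Bool.Properties using (∧-conicalˡ; ∧-conicalʳ; ∨-zeroʳ; ¬-not)
open import Data.Fin using (Fin; zero; suc; _≟_; _↑ˡ_; _↑ʳ_; combine; quotient; remainder)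
import Data.Fin.Properties as Finᵖ
open import Data.Fin.Subset using (Subset; _∩_; ⋂; ∣_∣; Nonempty) renaming (⊥ to ∅)
open import Data.Fin.Subset.Properties using (nonempty?; ∣⊥∣≡0)
open import Data.Vec using (Vec; []; _∷_; lookup; tabulate)
open import Data.Vec.Properties using (lookup-zipWith; lookup∘tabulate; lookup-replicate; lookup⇒[]=; []=⇒lookup)
import Data.Vec.Functional as Vector
open import Data.Vec.Functional.Properties using (updateAt-updates; updateAt-minimal)
import Data.List as List
open import Data.List.Relation.Unary.All as All using (all?)
open import Data.List.Relation.Unary.All.Properties using (¬All⇒Any¬)
open import Data.List.Relation.Unary.Any as Any using (here)
open import Data.List.Membership.Propositional using (_∈_; find; lose)
open import Data.List.Membership.Propositional.Properties
  using (∈-map⁺; ∈-concat⁺′; ∈-allFin; ∈-map∘filter⁻; ∈-map∘filter⁺)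
open import Algebra.Properties.CommutativeMonoid.Sum +-0-commutativeMonoid
  using (sum; sum-syntax; ∑-distrib-+; ∑-comm; sum-cong-≗; sum-replicate-zero)
open import Data.Product using (_,_; proj₁; proj₂; ∃)
open import Data.Sum using (inj₁; inj₂)
open import Data.Empty using (⊥; ⊥-elim)
open import Relation.Nullary using (yes; no)
open import Relation.Nullary.Decidable using (isYes; isYes≗does; dec-true)
open import Relation.Binary.PropositionalEquality using (_≢_; refl; sym; trans; cong; cong₂; subst; module ≡-Reasoning)
open import Function using (_∘_)

∑-mono : ∀ {n} {f g : Fin n → ℕ} → (∀ i → f i ≤ g i) → sum f ≤ sum g
∑-mono {zero}  _   = z≤n
∑-mono {suc n} f≤g = +-mono-≤ (f≤g zero) (∑-mono (f≤g ∘ suc))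

∑-const : ∀ n c → ∑[ i < n ] c ≡ n * c
∑-const zero    c = refl
∑-const (suc n) c = cong (c +_) (∑-const n c)

term≤∑ : ∀ {n} (f : Fin n → ℕ) i → f i ≤ sum f
term≤∑ f zero    = m≤m+n _ _
term≤∑ f (suc i) = ≤-trans (term≤∑ (f ∘ suc) i) (m≤n+m _ _)

∑-split : ∀ m {n} (f : Fin (m + n) → ℕ) →
          sum f ≡ ∑[ i < m ] f (i ↑ˡ n) + ∑[ j < n ] f (m ↑ʳ j)
∑-split zero    f = refl
∑-split (suc m) f = trans (cong (f zero +_) (∑-split m (f ∘ suc))) (sym (+-assoc (f zero) _ _))

∑-combine : ∀ m {n} (f : Fin (m * n) → ℕ) →
            sum f ≡ ∑[ i < m ] ∑[ j < n ] f (combine i j)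
∑-combine zero    f = refl
∑-combine (suc m) {n} f =
  trans (∑-split n f) (cong (∑[ j < n ] f (j ↑ˡ (m * n)) +_) (∑-combine m (λ v → f (n ↑ʳ v))))

true≢false : true ≢ false
true≢false ()

𝟙 : Bool → ℕ
𝟙 true  = 1
𝟙 false = 0

count : ∀ {n} → (Fin n → Bool) → ℕ
count {n} b = ∑[ x < n ] 𝟙 (b x)

count-cong : ∀ {n} {b c : Fin n → Bool} → (∀ x → b x ≡ c x) → count b ≡ count c
count-cong b≗c = sum-cong-≗ (cong 𝟙 ∘ b≗c)

count-none : ∀ {n} {b : Fin n → Bool} → (∀ x → b x ≡ false) → count b ≡ 0
count-none {n} none = trans (count-cong none) (sum-replicate-zero n)

count-all : ∀ {n} {b : Fin n → Bool} → (∀ x → b x ≡ true) → count b ≡ n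
count-all {n} all = trans (count-cong all) (trans (∑-const n 1) (*-identityʳ n))

count-positive : ∀ {n} (b : Fin n → Bool) x → b x ≡ true → 1 ≤ count b
count-positive b x bx = ≤-trans (≤-reflexive (cong 𝟙 (sym bx))) (term≤∑ (𝟙 ∘ b) x)

𝟙-mono : ∀ {a b} → (a ≡ true → b ≡ true) → 𝟙 a ≤ 𝟙 b
𝟙-mono {false} _   = z≤n
𝟙-mono {true}  a⇒b rewrite a⇒b refl = ≤-refl

𝟙-∧ : ∀ a b → 𝟙 (a ∧ b) ≤ 𝟙 b
𝟙-∧ a b = 𝟙-mono (∧-conicalʳ a b)

𝟙-cover : ∀ a b c → (c ≡ true → a ≡ true ⊎ b ≡ true) → 𝟙 c ≤ 𝟙 a + 𝟙 b
𝟙-cover a b false _ = z≤n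
𝟙-cover a b true  c⇒a∨b with c⇒a∨b refl
... | inj₁ refl = s≤s z≤n
... | inj₂ refl = m≤n+m 1 (𝟙 a)

𝟙-disjoint : ∀ a b c → (a ≡ true → b ≡ true → ⊥) →
             (a ≡ true → c ≡ true) → (b ≡ true → c ≡ true) → 𝟙 a + 𝟙 b ≤ 𝟙 c
𝟙-disjoint true  true  c apart _   _   = ⊥-elim (apart refl refl)
𝟙-disjoint true  false c _     a⇒c _   = 𝟙-mono {true} a⇒c
𝟙-disjoint false true  c _     _   b⇒c = 𝟙-mono {true} b⇒c
𝟙-disjoint false false c _     _   _   = z≤n

AtMostOne : ∀ {n} → (Fin n → Bool) → Set
AtMostOne b = ∀ x y → b x ≡ true → b y ≡ true → x ≡ y

count≥2 : ∀ {n} (b : Fin (suc n) → Bool) y → b zero ≡ true → b (suc y) ≡ true → 2 ≤ count b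
count≥2 b y b0 by = +-mono-≤ (≤-reflexive (cong 𝟙 (sym b0))) (count-positive (b ∘ suc) y by)

count≤1⇒atMostOne : ∀ {n} (b : Fin n → Bool) → count b ≤ 1 → AtMostOne b
count≤1⇒atMostOne b c≤1 zero    zero    _  _  = refl
count≤1⇒atMostOne b c≤1 zero    (suc y) bx by = ⊥-elim (1+n≰n (≤-trans (count≥2 b y bx by) c≤1))
count≤1⇒atMostOne b c≤1 (suc x) zero    bx by = ⊥-elim (1+n≰n (≤-trans (count≥2 b x by bx) c≤1))
count≤1⇒atMostOne b c≤1 (suc x) (suc y) bx by =
  cong suc (count≤1⇒atMostOne (b ∘ suc) (≤-trans (m≤n+m _ (𝟙 (b zero))) c≤1) x y bx by)

atMostOne⇒count≤1 : ∀ {n} (b : Fin n → Bool) → AtMostOne b → count b ≤ 1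
atMostOne⇒count≤1 {zero}  b _    = z≤n
atMostOne⇒count≤1 {suc n} b once with b zero in b0
... | true  = s≤s (≤-reflexive (count-none tail-false))
  where
  tail-false : ∀ x → b (suc x) ≡ false
  tail-false x with b (suc x) in bx
  ... | false = refl
  ... | true with once zero (suc x) b0 bx
  ...   | ()
... | false = atMostOne⇒count≤1 (b ∘ suc) (λ x y bx by → Finᵖ.suc-injective (once (suc x) (suc y) bx by))

count-one : ∀ {n} (b : Fin n → Bool) x → b x ≡ true → AtMostOne b → count b ≡ 1
count-one b x bx once = ≤-antisym (atMostOne⇒count≤1 b once) (count-positive b x bx)

⋀ ⋁ : ∀ {p} → (Fin p → Bool) → Bool
⋀ = Vector.foldr _∧_ true
⋁ = Vector.foldr _∨_ false

⋀-true : ∀ {p} {b : Fin p → Bool} → ⋀ b ≡ true → ∀ i → b i ≡ true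
⋀-true {b = b} all zero    = ∧-conicalˡ (b zero) _ all
⋀-true {b = b} all (suc i) = ⋀-true {b = b ∘ suc} (∧-conicalʳ (b zero) _ all) i

⋀-intro : ∀ {p} {b : Fin p → Bool} → (∀ i → b i ≡ true) → ⋀ b ≡ true
⋀-intro {zero}          _   = refl
⋀-intro {suc p} {b} all rewrite all zero = ⋀-intro {b = b ∘ suc} (all ∘ suc)

⋀-cong : ∀ {p} {b c : Fin p → Bool} → (∀ i → b i ≡ c i) → ⋀ b ≡ ⋀ c
⋀-cong {zero}  _   = refl
⋀-cong {suc p} b≗c = cong₂ _∧_ (b≗c zero) (⋀-cong (b≗c ∘ suc))

⋁-witness : ∀ {p} {b : Fin p → Bool} → ⋁ b ≡ true → ∃ λ i → b i ≡ true
⋁-witness {suc p} {b} some with b zero in b0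
... | true  = zero , b0
... | false = let i , bi = ⋁-witness {b = b ∘ suc} some in suc i , bi

⋁-false : ∀ {p} {b : Fin p → Bool} → ⋁ b ≡ false → ∀ i → b i ≡ false
⋁-false {b = b} none zero with b zero | none
... | false | _ = refl
⋁-false {b = b} none (suc i) with b zero | none
... | false | none′ = ⋁-false {b = b ∘ suc} none′ i

count≤𝟙⋁ : ∀ {p} (b : Fin p → Bool) → AtMostOne b → count b ≤ 𝟙 (⋁ b)
count≤𝟙⋁ b once with ⋁ b in some
... | true  = atMostOne⇒count≤1 b once
... | false = ≤-reflexive (count-none {b = b} (⋁-false some))

≡⇒≟-true : ∀ {n} {a b : Fin n} → a ≡ b → isYes (a ≟ b) ≡ true
≡⇒≟-true {a = a} refl = trans (isYes≗does (a ≟ a)) (dec-true (a ≟ a) refl)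

≟-true⇒≡ : ∀ {n} {a b : Fin n} → isYes (a ≟ b) ≡ true → a ≡ b
≟-true⇒≡ {a = a} {b} a≟b with a ≟ b
... | yes a≡b = a≡b

_⊆ᵇ_ : ∀ {n} → Subset n → (Fin n → Bool) → Set
X ⊆ᵇ C = ∀ x → lookup X x ≡ true → C x ≡ true

Disjoint : ∀ {n} → Subset n → Subset n → Set
Disjoint X f = ∀ x → lookup X x ≡ true → lookup f x ≡ true → ⊥

lookup-∩ : ∀ {n} (X Y : Subset n) x → lookup (X ∩ Y) x ≡ lookup X x ∧ lookup Y x
lookup-∩ X Y x = lookup-zipWith _∧_ x X Y

∣∣≡count : ∀ {n} (X : Subset n) → ∣ X ∣ ≡ count (lookup X)
∣∣≡count []          = refl
∣∣≡count (true ∷ X)  = cong suc (∣∣≡count X)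
∣∣≡count (false ∷ X) = ∣∣≡count X

choose : ∀ {n} (C : Fin n → Bool) k → k ≤ count C → Σ (Subset n) λ X → ∣ X ∣ ≡ k × X ⊆ᵇ C
choose {n} C zero _ = ∅ , ∣⊥∣≡0 n , λ x x∈∅ → ⊥-elim (true≢false (trans (sym x∈∅) (lookup-replicate x false)))
choose {suc n} C (suc k) k<C with C zero in C0
... | true  = let X , ∣X∣ , X⊆C = choose (C ∘ suc) k (≤-pred k<C)
              in true ∷ X , cong suc ∣X∣ , λ { zero _ → C0 ; (suc x) → X⊆C x }
... | false = let X , ∣X∣ , X⊆C = choose (C ∘ suc) (suc k) k<C
              in false ∷ X , ∣X∣ , λ { (suc x) → X⊆C x }

disjoint-count : ∀ {n} (f : Subset n) (C : Fin n → Bool) (X : Subset n) → X ⊆ᵇ C → Disjoint X f →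
                 count (λ x → lookup f x ∧ C x) + ∣ X ∣ ≤ count C
disjoint-count f C X X⊆C X∩f=∅ = begin
  count (λ x → lookup f x ∧ C x) + ∣ X ∣             ≡⟨ cong (_ +_) (∣∣≡count X) ⟩
  count (λ x → lookup f x ∧ C x) + count (lookup X)  ≡⟨ sym (∑-distrib-+ (λ x → 𝟙 (lookup f x ∧ C x)) (𝟙 ∘ lookup X)) ⟩
  ∑[ x < _ ] (𝟙 (lookup f x ∧ C x) + 𝟙 (lookup X x)) ≤⟨ ∑-mono pointwise ⟩
  count C                                            ∎
  where
  open ≤-Reasoning
  pointwise : ∀ x → 𝟙 (lookup f x ∧ C x) + 𝟙 (lookup X x) ≤ 𝟙 (C x)
  pointwise x = 𝟙-disjoint _ _ _ (λ in-f in-X → X∩f=∅ x in-X (∧-conicalˡ _ _ in-f))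
                              (∧-conicalʳ (lookup f x) _) (X⊆C x)

core : ∀ {n p} → (Fin p → Subset n) → Fin n → Bool
core es x = ⋀ (λ i → lookup (es i) x)

in-core : ∀ {n p} {es : Fin p → Subset n} {x} → core es x ≡ true → ∀ l → lookup (es l) x ≡ true
in-core {es = es} {x} = ⋀-true {b = λ l → lookup (es l) x}

size : ∀ {n p} → (Fin p → Subset n) → ℕ
size es = count (core es)

∣⋂∣≡size : ∀ {n p} (es : Fin p → Subset n) → ∣ ⋂ (List.tabulate es) ∣ ≡ size es
∣⋂∣≡size es = trans (∣∣≡count (⋂ (List.tabulate es))) (count-cong (lookup-⋂ es))
  where
  lookup-⋂ : ∀ {n p} (es : Fin p → Subset n) x → lookup (⋂ (List.tabulate es)) x ≡ core es x
  lookup-⋂ {p = zero}  es x = lookup-replicate x true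
  lookup-⋂ {p = suc p} es x =
    trans (lookup-∩ (es zero) _ x) (cong (lookup (es zero) x ∧_) (lookup-⋂ (es ∘ suc) x))

replace : ∀ {n p} → (Fin p → Subset n) → Fin p → Subset n → Fin p → Subset n
replace es i f = Vector.updateAt es i (λ _ → f)

core-replace-new : ∀ {n p} {es : Fin p → Subset n} {i f x} →
                   core (replace es i f) x ≡ true → lookup f x ≡ true
core-replace-new {es = es} {i} {f} {x} x∈core =
  trans (cong (λ e → lookup e x) (sym (updateAt-updates i es))) (in-core {es = replace es i f} x∈core i)

core-replace-old : ∀ {n p} {es : Fin p → Subset n} {i f x} →
                   core (replace es i f) x ≡ true → ∀ l → l ≢ i → lookup (es l) x ≡ true
core-replace-old {es = es} {i} {f} {x} x∈core l l≢i =
  trans (cong (λ e → lookup e x) (sym (updateAt-minimal l i es l≢i))) (in-core {es = replace es i f} x∈core l)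

module Covering (H : Hypergraph) where

  AllEdges : ∀ {p} → (Fin p → Subset (n H)) → Set
  AllEdges es = ∀ i → IsEdge H (es i)

  Stable : ∀ {p} → (Fin p → Subset (n H)) → Set
  Stable es = ∀ i f → IsEdge H f → size es ≤ size (replace es i f)

  replace-edges : ∀ {p} {es : Fin p → Subset (n H)} {f} → AllEdges es → IsEdge H f → ∀ i → AllEdges (replace es i f)
  replace-edges {es = es} ok f-edge i l with l ≟ i
  ... | yes refl = subst (IsEdge H) (sym (updateAt-updates l es)) f-edge
  ... | no l≢i   = subst (IsEdge H) (sym (updateAt-minimal l i es l≢i)) (ok l)

  stabilise : ∀ {p} (es : Fin p → Subset (n H)) → AllEdges es →
              Σ (Fin p → Subset (n H)) λ es′ → AllEdges es′ × Stable es′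
  stabilise es ok = descend es ok (<-wellFounded (size es))
    where
    descend : ∀ {p} (es : Fin p → Subset (n H)) → AllEdges es → Acc _<_ (size es) →
              Σ (Fin p → Subset (n H)) λ es′ → AllEdges es′ × Stable es′
    descend es ok (acc smaller)
      with Finᵖ.any? (λ i → Any.any? (λ f → size (replace es i f) <? size es) (edges H))
    ... | yes (i , shrinking) =
            let f , f-edge , shrinks = find shrinking
            in descend (replace es i f) (replace-edges ok f-edge i) (smaller shrinks)
    ... | no none = es , ok , λ i f f-edge → ≮⇒≥ (λ shrinks → none (i , lose f-edge shrinks))

  edgeless-or-stable : ∀ p → (∀ m → CoverNumber≤ H m) ⊎
                       Σ (Fin p → Subset (n H)) λ es → AllEdges es × Stable es
  edgeless-or-stable p = by-cases (edges H) refl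
    where
    by-cases : ∀ l → edges H ≡ l → (∀ m → CoverNumber≤ H m) ⊎
               Σ (Fin p → Subset (n H)) λ es → AllEdges es × Stable es
    by-cases List.[] no-edges = inj₁ λ m →
      ∅ , (λ e e-edge → no-edge (subst (e ∈_) no-edges e-edge)) , ≤-trans (≤-reflexive (∣⊥∣≡0 (n H))) z≤n
      where
      no-edge : ∀ {e} → e ∈ List.[] → Nonempty (∅ ∩ e)
      no-edge ()
    by-cases (e List.∷ _) first = inj₂ (stabilise (λ _ → e) (λ _ → subst (e ∈_) (sym first) (here refl)))

  cover-or-avoid : (X : Subset (n H)) → IsCover H X ⊎ Σ (Subset (n H)) λ f → IsEdge H f × Disjoint X f
  cover-or-avoid X with all? (λ e → nonempty? (X ∩ e)) (edges H)
  ... | yes meets-all = inj₁ λ e e-edge → All.lookup meets-all e-edge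
  ... | no ¬meets-all with find (¬All⇒Any¬ (λ e → nonempty? (X ∩ e)) (edges H) ¬meets-all)
  ...   | f , f-edge , misses = inj₂ (f , f-edge , λ x x∈X x∈f →
            misses (x , lookup⇒[]= x (X ∩ f) (trans (lookup-∩ X f x) (cong₂ _∧_ x∈X x∈f))))

  -- If every edge meets C in at least t vertices, then every X ⊆ C with
  -- |C| < t + |X| is a cover: an edge avoiding X meets C only outside X.
  thick-cover : ∀ t (C : Fin (n H) → Bool) (X : Subset (n H)) →
                (∀ f → IsEdge H f → t ≤ count (λ x → lookup f x ∧ C x)) →
                X ⊆ᵇ C → count C < t + ∣ X ∣ → IsCover H X
  thick-cover t C X thick X⊆C C<t+X with cover-or-avoid X
  ... | inj₁ covers = covers
  ... | inj₂ (f , f-edge , X∩f=∅) =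
        ⊥-elim (<⇒≱ C<t+X (≤-trans (+-monoˡ-≤ ∣ X ∣ (thick f f-edge)) (disjoint-count f C X X⊆C X∩f=∅)))

floor-bound : ∀ r t k .{{_ : NonZero k}} → t ≤ r → r < t + k * suc ((r ∸ t) / k)
floor-bound r t k t≤r = begin-strict
  r                                  ≡⟨ sym (m+[n∸m]≡n t≤r) ⟩
  t + (r ∸ t)                        ≡⟨ cong (t +_) (m≡m%n+[m/n]*n (r ∸ t) k) ⟩
  t + ((r ∸ t) % k + m * k)          <⟨ +-monoʳ-< t (+-monoˡ-< (m * k) (m%n<n (r ∸ t) k)) ⟩
  t + suc m * k                      ≡⟨ cong (t +_) (*-comm (suc m) k) ⟩
  t + k * suc m                      ∎
  where
  open ≤-Reasoning
  m = (r ∸ t) / k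

half-gap<t : ∀ r t → t ≤ r → r < 3 * t → (r ∸ t) / 2 < t
half-gap<t r t t≤r r<3t = m<n*o⇒m/o<n (begin-strict
  r ∸ t      <⟨ ∸-monoˡ-< r<3t t≤r ⟩
  3 * t ∸ t  ≡⟨ m+n∸m≡n t (2 * t) ⟩
  2 * t      ≡⟨ *-comm 2 t ⟩
  t * 2      ∎)
  where open ≤-Reasoning

-- Size of the cover taken from a core of s ≤ t + m vertices.
excess-bound : ∀ s t m → s ≤ t + m → suc s ∸ t ≤ m + 1
excess-bound s t m s≤t+m = begin
  suc s ∸ t        ≤⟨ ∸-monoˡ-≤ t (s≤s s≤t+m) ⟩
  suc (t + m) ∸ t  ≡⟨ cong (_∸ t) (sym (+-suc t m)) ⟩
  t + suc m ∸ t    ≡⟨ m+n∸m≡n t (suc m) ⟩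
  suc m            ≡⟨ +-comm 1 m ⟩
  m + 1            ∎
  where open ≤-Reasoning

-- A core of s > t + m vertices absorbs one of the p + 1 blocks of size m + 1.
shift-bound : ∀ t m s p → t + m < s → t + suc p * suc m ≤ s + p * suc m
shift-bound t m s p t+m<s = begin
  t + (suc m + p * suc m)  ≡⟨ sym (+-assoc t (suc m) _) ⟩
  t + suc m + p * suc m    ≡⟨ cong (_+ p * suc m) (+-suc t m) ⟩
  suc (t + m) + p * suc m  ≤⟨ +-monoˡ-≤ (p * suc m) t+m<s ⟩
  s + p * suc m            ∎
  where open ≤-Reasoning

-- Partite hypergraphs: the exchange lemma

module PartiteHypergraph (H : Hypergraph) {r : ℕ} (part : Fin (n H) → Fin r)
       (partite : ∀ e → IsEdge H e → ∀ j → ∣ e ∩ PartOf part j ∣ ≡ 1) where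

  open Covering H

  V : Set
  V = Fin (n H)

  Transversal : (V → Bool) → Set
  Transversal U = ∀ x y → U x ≡ true → U y ≡ true → part x ≡ part y → x ≡ y

  edge-transversal : ∀ e → IsEdge H e → Transversal (lookup e)
  edge-transversal e e-edge x y x∈e y∈e same-part =
    count≤1⇒atMostOne in-part-of-x (≤-reflexive one) x y (in-part x∈e refl) (in-part y∈e (sym same-part))
    where
    in-part-of-x : V → Bool
    in-part-of-x z = lookup e z ∧ isYes (part z ≟ part x)
    in-part : ∀ {z} → lookup e z ≡ true → part z ≡ part x → in-part-of-x z ≡ true
    in-part z∈e same = cong₂ _∧_ z∈e (≡⇒≟-true same)
    one : count in-part-of-x ≡ 1
    one = trans (sym (count-cong λ z → trans (lookup-∩ e _ z) (cong (lookup e z ∧_) (lookup∘tabulate _ z))))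
                (trans (sym (∣∣≡count (e ∩ PartOf part (part x)))) (partite e e-edge (part x)))

  transversal-bound : ∀ U → Transversal U → count U ≤ r
  transversal-bound U once = begin
    count U                                              ≡⟨ sum-cong-≗ by-part ⟩
    ∑[ x < n H ] ∑[ j < r ] 𝟙 (U x ∧ isYes (part x ≟ j)) ≡⟨ ∑-comm (λ x j → 𝟙 (U x ∧ isYes (part x ≟ j))) ⟩
    ∑[ j < r ] count (λ x → U x ∧ isYes (part x ≟ j))   ≤⟨ ∑-mono one-per-part ⟩
    ∑[ j < r ] 1                                         ≡⟨ trans (∑-const r 1) (*-identityʳ r) ⟩
    r                                                    ∎
    where
    open ≤-Reasoning
    by-part : ∀ x → 𝟙 (U x) ≡ count (λ j → U x ∧ isYes (part x ≟ j))
    by-part x with U x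
    ... | true  = sym (count-one _ (part x) (≡⇒≟-true refl)
                        (λ j j′ at-j at-j′ → trans (sym (≟-true⇒≡ at-j)) (≟-true⇒≡ at-j′)))
    ... | false = sym (count-none {r} {λ _ → false} λ _ → refl)
    one-per-part : ∀ j → count (λ x → U x ∧ isYes (part x ≟ j)) ≤ 1
    one-per-part j = atMostOne⇒count≤1 _ λ x y in-x in-y →
      once x y (∧-conicalˡ _ _ in-x) (∧-conicalˡ _ _ in-y)
               (trans (≟-true⇒≡ (∧-conicalʳ (U x) _ in-x)) (sym (≟-true⇒≡ (∧-conicalʳ (U y) _ in-y))))

  other : ∀ {q} → Fin (suc (suc q)) → Fin (suc (suc q))
  other zero    = suc zero
  other (suc _) = zero

  other≢ : ∀ {q} (i : Fin (suc (suc q))) → other i ≢ i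
  other≢ zero    ()
  other≢ (suc _) ()

  module Exchange {q : ℕ} (es : Fin (suc (suc q)) → Subset (n H)) (es-edges : AllEdges es)
                  (f : Subset (n H)) (f-edge : IsEdge H f)
                  (X : Subset (n H)) (X⊆core : X ⊆ᵇ core es) (X∩f=∅ : Disjoint X f) where

    p : ℕ
    p = suc (suc q)

    gained : Fin p → V → Bool
    gained i x = core (replace es i f) x ∧ not (lookup (es i) x)

    in-f : ∀ {i x} → gained i x ≡ true → lookup f x ≡ true
    in-f {i} {x} g = core-replace-new {es = es} {i} {f} (∧-conicalˡ _ (not (lookup (es i) x)) g)

    in-others : ∀ {i x} → gained i x ≡ true → ∀ l → l ≢ i → lookup (es l) x ≡ true
    in-others {i} {x} g = core-replace-old {es = es} {i} {f} (∧-conicalˡ _ (not (lookup (es i) x)) g)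

    not-in-es : ∀ {i x} → gained i x ≡ true → lookup (es i) x ≡ false
    not-in-es {i} {x} g with lookup (es i) x | ∧-conicalʳ (core (replace es i f) x) _ g
    ... | false | _ = refl

    exchanged-core : ∀ i → size (replace es i f) ≤ count (λ x → lookup f x ∧ core es x) + count (gained i)
    exchanged-core i = ≤-trans (∑-mono λ x → 𝟙-cover _ _ _ (old-or-gained x))
                               (≤-reflexive (∑-distrib-+ (λ x → 𝟙 (lookup f x ∧ core es x)) (𝟙 ∘ gained i)))
      where
      old-or-gained : ∀ x → core (replace es i f) x ≡ true →
                      lookup f x ∧ core es x ≡ true ⊎ gained i x ≡ true
      old-or-gained x x∈core with lookup (es i) x in in-esᵢ
      ... | true  = inj₁ (cong₂ _∧_ (core-replace-new {es = es} {i} {f} x∈core) (⋀-intro in-es))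
        where
        in-es : ∀ l → lookup (es l) x ≡ true
        in-es l with l ≟ i
        ... | yes refl = in-esᵢ
        ... | no l≢i   = core-replace-old {es = es} {i} {f} x∈core l l≢i
      ... | false = inj₂ (cong (_∧ true) x∈core)

    gained-once : ∀ x → AtMostOne (λ i → gained i x)
    gained-once x i j gᵢ gⱼ with j ≟ i
    ... | yes j≡i = sym j≡i
    ... | no j≢i  = ⊥-elim (true≢false (trans (sym (in-others gᵢ j j≢i)) (not-in-es gⱼ)))

    core-not-gained : ∀ x → core es x ≡ true → ⋁ (λ i → gained i x) ≡ true → ⊥
    core-not-gained x x∈core some =
      let i , gᵢ = ⋁-witness {b = λ i → gained i x} some
      in true≢false (trans (sym (in-core {es = es} x∈core i)) (not-in-es gᵢ))

    covered : V → Bool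
    covered x = core es x ∨ ⋁ (λ i → gained i x)

    classify : ∀ {z} → covered z ≡ true → core es z ≡ true ⊎ ∃ λ i → gained i z ≡ true
    classify {z} in-z with core es z
    ... | true  = inj₁ refl
    ... | false = inj₂ (⋁-witness in-z)

    covered-transversal : Transversal covered
    covered-transversal x y in-x in-y same-part with classify in-x | classify in-y
    ... | inj₁ core-x       | inj₁ core-y       =
          edge-transversal (es zero) (es-edges zero) x y (in-core {es = es} core-x zero) (in-core {es = es} core-y zero) same-part
    ... | inj₁ core-x       | inj₂ (i , gained-y) =
          edge-transversal (es (other i)) (es-edges (other i)) x y
            (in-core {es = es} core-x (other i)) (in-others gained-y (other i) (other≢ i)) same-part
    ... | inj₂ (i , gained-x) | inj₁ core-y     =
          edge-transversal (es (other i)) (es-edges (other i)) x y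
            (in-others gained-x (other i) (other≢ i)) (in-core {es = es} core-y (other i)) same-part
    ... | inj₂ (_ , gained-x) | inj₂ (_ , gained-y) =
          edge-transversal f f-edge x y (in-f gained-x) (in-f gained-y) same-part

    exchange : (∀ i → size es ≤ size (replace es i f)) → size es + p * ∣ X ∣ ≤ r
    exchange stable = begin
      size es + p * ∣ X ∣                                    ≡⟨ cong (size es +_) (sym (∑-const p ∣ X ∣)) ⟩
      size es + ∑[ i < p ] ∣ X ∣                             ≤⟨ +-monoʳ-≤ (size es) (∑-mono X≤gained) ⟩
      size es + ∑[ i < p ] count (gained i)                  ≡⟨ cong (size es +_) (∑-comm (λ i x → 𝟙 (gained i x))) ⟩
      size es + ∑[ x < n H ] count (λ i → gained i x)        ≡⟨ sym (∑-distrib-+ (𝟙 ∘ core es) _) ⟩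
      ∑[ x < n H ] (𝟙 (core es x) + count (λ i → gained i x)) ≤⟨ ∑-mono counted-once ⟩
      count covered                                          ≤⟨ transversal-bound covered covered-transversal ⟩
      r                                                      ∎
      where
      open ≤-Reasoning
      X≤gained : ∀ i → ∣ X ∣ ≤ count (gained i)
      X≤gained i = +-cancelˡ-≤ (count (λ x → lookup f x ∧ core es x)) _ _
        (≤-trans (disjoint-count f (core es) X X⊆core X∩f=∅) (≤-trans (stable i) (exchanged-core i)))
      counted-once : ∀ x → 𝟙 (core es x) + count (λ i → gained i x) ≤ 𝟙 (covered x)
      counted-once x = ≤-trans (+-monoʳ-≤ (𝟙 (core es x)) (count≤𝟙⋁ _ (gained-once x)))
                               (𝟙-disjoint _ _ (covered x) (core-not-gained x) from-core from-gained)
        where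
        from-core : core es x ≡ true → covered x ≡ true
        from-core c = cong (_∨ ⋁ (λ i → gained i x)) c
        from-gained : ⋁ (λ i → gained i x) ≡ true → covered x ≡ true
        from-gained g = trans (cong (core es x ∨_) g) (∨-zeroʳ _)

  -- Any m + 1 vertices of the core of a stable tuple of p edges cover H,
  -- provided r < |core| + p(m + 1); otherwise the exchange lemma fails.
  stable-core-cover : ∀ {q} m (es : Fin (suc (suc q)) → Subset (n H)) → AllEdges es → Stable es →
                      suc m ≤ size es → r < size es + suc (suc q) * suc m → CoverNumber≤ H (m + 1)
  stable-core-cover {q} m es es-edges stable m<core gap with choose (core es) (suc m) m<core
  ... | X , ∣X∣≡m+1 , X⊆core with cover-or-avoid X
  ...   | inj₁ covers = X , covers , ≤-reflexive (trans ∣X∣≡m+1 (+-comm 1 m))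
  ...   | inj₂ (f , f-edge , X∩f=∅) = ⊥-elim (<⇒≱ gap
            (subst (λ x → size es + suc (suc q) * x ≤ r) ∣X∣≡m+1
              (Exchange.exchange es es-edges f f-edge X X⊆core X∩f=∅ (λ i → stable i f f-edge))))

  -- k = 2 and 3t > r: the core of a stable pair has t > m vertices.
  upper-bound-pairs : ∀ t → t ≤ r → r < 3 * t → KWiseIntersecting 2 t H → CoverNumber≤ H ((r ∸ t) / 2 + 1)
  upper-bound-pairs t t≤r r<3t pairwise with edgeless-or-stable 2
  ... | inj₁ edgeless = edgeless _
  ... | inj₂ (es , es-edges , stable) =
        stable-core-cover m es es-edges stable (≤-trans (half-gap<t r t t≤r r<3t) t≤core)
                          (≤-trans (floor-bound r t 2 t≤r) (+-monoˡ-≤ (2 * suc m) t≤core))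
    where
    m = (r ∸ t) / 2
    t≤core : t ≤ size es
    t≤core = subst (t ≤_) (∣⋂∣≡size es) (pairwise es es-edges)

  -- k = p + 1 ≥ 3: every edge meets the core of a stable p-tuple in at least
  -- t vertices.  A small core is covered by any |core| + 1 - t of its vertices,
  -- a large one by any m + 1 of them.
  stable-tuple-cover : ∀ q t m → 1 ≤ t → r < t + suc (suc (suc q)) * suc m →
                       (es : Fin (suc (suc q)) → Subset (n H)) → AllEdges es → Stable es →
                       (∀ f → IsEdge H f → t ≤ count (λ x → lookup f x ∧ core es x)) →
                       CoverNumber≤ H (m + 1)
  stable-tuple-cover q t m 1≤t gap es es-edges stable thick with size es ≤? t + m
  ... | no large = stable-core-cover m es es-edges stable (≤-trans (s≤s (m≤n+m m t)) (≰⇒> large))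
                     (≤-trans gap (shift-bound t m (size es) (suc (suc q)) (≰⇒> large)))
  ... | yes small with choose (core es) (suc (size es) ∸ t) (∸-monoʳ-≤ (suc (size es)) 1≤t)
  ...   | X , ∣X∣ , X⊆core =
          X , thick-cover t (core es) X thick X⊆core core<t+X , ≤-trans (≤-reflexive ∣X∣) (excess-bound (size es) t m small)
    where
    t≤core : t ≤ size es
    t≤core = ≤-trans (thick (es zero) (es-edges zero)) (∑-mono λ x → 𝟙-∧ (lookup (es zero) x) (core es x))
    core<t+X : size es < t + ∣ X ∣
    core<t+X = ≤-reflexive (sym (trans (cong (t +_) ∣X∣) (m+[n∸m]≡n (≤-trans t≤core (n≤1+n (size es))))))

  upper-bound-many : ∀ q t → 1 ≤ t → t ≤ r → KWiseIntersecting (suc (suc (suc q))) t H →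
                     CoverNumber≤ H ((r ∸ t) / suc (suc (suc q)) + 1)
  upper-bound-many q t 1≤t t≤r kwise with edgeless-or-stable (suc (suc q))
  ... | inj₁ edgeless = edgeless _
  ... | inj₂ (es , es-edges , stable) =
        stable-tuple-cover q t _ 1≤t (floor-bound r t (suc (suc (suc q))) t≤r) es es-edges stable thick
    where
    thick : ∀ f → IsEdge H f → t ≤ count (λ x → lookup f x ∧ core es x)
    thick f f-edge = subst (t ≤_) (∣⋂∣≡size (f Vector.∷ es))
                       (kwise (f Vector.∷ es) λ { zero → f-edge ; (suc i) → es-edges i })

-- The extremal construction

allVectors : ∀ r q → List.List (Vec (Fin q) r)
allVectors zero    q = [] List.∷ List.[]
allVectors (suc r) q = List.concat (List.map (λ a → List.map (a ∷_) (allVectors r q)) (List.allFin q))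

∈-allVectors : ∀ {r q} (g : Vec (Fin q) r) → g ∈ allVectors r q
∈-allVectors []                = here refl
∈-allVectors {suc r} {q} (a ∷ g) =
  ∈-concat⁺′ (∈-map⁺ (a ∷_) (∈-allVectors g)) (∈-map⁺ (λ b → List.map (b ∷_) (allVectors r q)) (∈-allFin a))

nonzero : ∀ {q} → Fin q → Bool
nonzero zero    = false
nonzero (suc _) = true

zero-or-nonzero : ∀ {k q} (c : Fin k → Fin (suc q)) →
                  1 ≤ 𝟙 (⋀ (λ l → isYes (c l ≟ zero))) + count (λ l → nonzero (c l))
zero-or-nonzero {zero}  c = s≤s z≤n
zero-or-nonzero {suc k} c with c zero
... | zero  = zero-or-nonzero (c ∘ suc)
... | suc _ = s≤s z≤n

-- Parts j < r with vertices (j , a) of colours a ≤ m; the edges are the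
-- graphs of the colourings with at most m nonzero colours.
module Construction (r t k : ℕ) .{{_ : NonZero k}} (t≤r : t ≤ r) where

  m : ℕ
  m = (r ∸ t) / k

  Colour : Set
  Colour = Fin (suc m)

  N : ℕ
  N = r * suc m

  vertex : Fin r → Colour → Fin N
  vertex = combine

  part : Fin N → Fin r
  part = quotient (suc m)

  colour : Fin N → Colour
  colour = remainder {r} (suc m)

  part-vertex : ∀ j a → part (vertex j a) ≡ j
  part-vertex j a = cong proj₁ (Finᵖ.remQuot-combine j a)

  colour-vertex : ∀ j a → colour (vertex j a) ≡ a
  colour-vertex j a = cong proj₂ (Finᵖ.remQuot-combine j a)

  vertex-part-colour : ∀ v → vertex (part v) (colour v) ≡ v
  vertex-part-colour = Finᵖ.combine-remQuot {r} (suc m)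

  count-vertices : (b : Fin N → Bool) → count b ≡ ∑[ j < r ] count (λ a → b (vertex j a))
  count-vertices b = ∑-combine r (𝟙 ∘ b)

  Colouring : Set
  Colouring = Vec Colour r

  support : Colouring → ℕ
  support g = count (λ j → nonzero (lookup g j))

  graph : Colouring → Subset N
  graph g = tabulate (λ v → isYes (lookup g (part v) ≟ colour v))

  graph-at : ∀ g j a → lookup (graph g) (vertex j a) ≡ isYes (lookup g j ≟ a)
  graph-at g j a = trans (lookup∘tabulate _ (vertex j a))
                         (cong₂ (λ i b → isYes (lookup g i ≟ b)) (part-vertex j a) (colour-vertex j a))

  on-graph : ∀ g v → lookup (graph g) v ≡ true → lookup g (part v) ≡ colour v
  on-graph g v v∈g = ≟-true⇒≡ (trans (sym (lookup∘tabulate _ v)) v∈g)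

  H₀ : Hypergraph
  H₀ = mkHG N (List.map graph (List.filter (λ g → support g ≤? m) (allVectors r (suc m))))

  edge-colouring : ∀ e → IsEdge H₀ e → Σ Colouring λ g → e ≡ graph g × support g ≤ m
  edge-colouring e e-edge with ∈-map∘filter⁻ graph (λ g → support g ≤? m) {xs = allVectors r (suc m)} e-edge
  ... | g , _ , e≡g , small = g , e≡g , small

  graph-edge : ∀ g → support g ≤ m → IsEdge H₀ (graph g)
  graph-edge g small = ∈-map∘filter⁺ graph (λ g → support g ≤? m) (g , ∈-allVectors g , refl , small)

  uniform : Uniform r H₀
  uniform e e-edge with edge-colouring e e-edge
  ... | g , refl , _ = begin
    ∣ graph g ∣                                             ≡⟨ ∣∣≡count (graph g) ⟩
    count (lookup (graph g))                                ≡⟨ count-vertices (lookup (graph g)) ⟩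
    ∑[ j < r ] count (λ a → lookup (graph g) (vertex j a))  ≡⟨ sum-cong-≗ one-per-part ⟩
    ∑[ j < r ] 1                                            ≡⟨ trans (∑-const r 1) (*-identityʳ r) ⟩
    r                                                       ∎
    where
    open ≡-Reasoning
    one-per-part : ∀ j → count (λ a → lookup (graph g) (vertex j a)) ≡ 1
    one-per-part j = trans (count-cong (graph-at g j))
      (count-one (λ a → isYes (lookup g j ≟ a)) (lookup g j) (≡⇒≟-true refl) one-colour)
      where
      one-colour : AtMostOne (λ a → isYes (lookup g j ≟ a))
      one-colour a b at-a at-b = trans (sym (≟-true⇒≡ at-a)) (≟-true⇒≡ at-b)

  partite : Partite r H₀
  partite = part , one-per-part
    where
    one-per-part : ∀ e → IsEdge H₀ e → ∀ j → ∣ e ∩ PartOf part j ∣ ≡ 1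
    one-per-part e e-edge j with edge-colouring e e-edge
    ... | g , refl , _ = trans (∣∣≡count (graph g ∩ PartOf part j))
                               (count-one _ (vertex j (lookup g j)) in-both once)
      where
      in-both : lookup (graph g ∩ PartOf part j) (vertex j (lookup g j)) ≡ true
      in-both = trans (lookup-∩ (graph g) _ _)
        (cong₂ _∧_ (trans (graph-at g j _) (≡⇒≟-true refl))
                   (trans (lookup∘tabulate (λ v → isYes (part v ≟ j)) (vertex j (lookup g j))) (≡⇒≟-true (part-vertex j _))))
      the-vertex : ∀ v → lookup (graph g ∩ PartOf part j) v ≡ true → v ≡ vertex j (lookup g j)
      the-vertex v v∈ = begin
        v                             ≡⟨ sym (vertex-part-colour v) ⟩
        vertex (part v) (colour v)    ≡⟨ cong₂ vertex v∈Pⱼ (sym (trans (cong (lookup g) (sym v∈Pⱼ)) (on-graph g v v∈g))) ⟩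
        vertex j (lookup g j)         ∎
        where
        open ≡-Reasoning
        both = trans (sym (lookup-∩ (graph g) (PartOf part j) v)) v∈
        v∈g = ∧-conicalˡ _ _ both
        v∈Pⱼ = ≟-true⇒≡ (trans (sym (lookup∘tabulate _ v)) (∧-conicalʳ _ _ both))
      once : AtMostOne (lookup (graph g ∩ PartOf part j))
      once v w v∈ w∈ = trans (the-vertex v v∈) (sym (the-vertex w w∈))

  -- k colourings of support ≤ m all use colour 0 on at least r - km ≥ t parts.
  kwise : KWiseIntersecting k t H₀
  kwise es es-edges = subst (t ≤_) (sym (∣⋂∣≡size es)) (≤-trans t≤zeros zeros≤core)
    where
    g : Fin k → Colouring
    g l = proj₁ (edge-colouring (es l) (es-edges l))
    es≡graph : ∀ l → es l ≡ graph (g l)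
    es≡graph l = proj₁ (proj₂ (edge-colouring (es l) (es-edges l)))
    small : ∀ l → support (g l) ≤ m
    small l = proj₂ (proj₂ (edge-colouring (es l) (es-edges l)))
    zeros : Fin r → Bool
    zeros j = ⋀ (λ l → isYes (lookup (g l) j ≟ zero))
    r≤zeros+supports : r ≤ count zeros + ∑[ l < k ] support (g l)
    r≤zeros+supports = begin
      r                                                         ≡⟨ sym (trans (∑-const r 1) (*-identityʳ r)) ⟩
      ∑[ j < r ] 1                                              ≤⟨ ∑-mono (λ j → zero-or-nonzero (λ l → lookup (g l) j)) ⟩
      ∑[ j < r ] (𝟙 (zeros j) + count (λ l → nonzero (lookup (g l) j)))
                                                                ≡⟨ ∑-distrib-+ (𝟙 ∘ zeros) _ ⟩
      count zeros + ∑[ j < r ] count (λ l → nonzero (lookup (g l) j))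
                                                                ≡⟨ cong (count zeros +_) (∑-comm (λ j l → 𝟙 (nonzero (lookup (g l) j)))) ⟩
      count zeros + ∑[ l < k ] support (g l)                    ∎
      where open ≤-Reasoning
    supports≤r-t : ∑[ l < k ] support (g l) ≤ r ∸ t
    supports≤r-t = begin
      ∑[ l < k ] support (g l)  ≤⟨ ∑-mono small ⟩
      ∑[ l < k ] m              ≡⟨ trans (∑-const k m) (*-comm k m) ⟩
      m * k                     ≤⟨ m/n*n≤m (r ∸ t) k ⟩
      r ∸ t                     ∎
      where open ≤-Reasoning
    t≤zeros : t ≤ count zeros
    t≤zeros = +-cancelʳ-≤ (r ∸ t) t (count zeros)
      (≤-trans (≤-reflexive (m+[n∸m]≡n t≤r)) (≤-trans r≤zeros+supports (+-monoʳ-≤ (count zeros) supports≤r-t)))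
    zero-in-core : ∀ j → zeros j ≡ core es (vertex j zero)
    zero-in-core j = ⋀-cong λ l →
      sym (trans (cong (λ e → lookup e (vertex j zero)) (es≡graph l)) (graph-at (g l) j zero))
    zeros≤core : count zeros ≤ size es
    zeros≤core = begin
      count zeros                                       ≡⟨ count-cong zero-in-core ⟩
      ∑[ j < r ] 𝟙 (core es (vertex j zero))
        ≤⟨ ∑-mono (λ j → term≤∑ (λ a → 𝟙 (core es (vertex j a))) zero) ⟩
      ∑[ j < r ] count (λ a → core es (vertex j a))    ≡⟨ sym (count-vertices (core es)) ⟩
      size es                                           ∎
      where open ≤-Reasoning

  free-colour : ∀ C → ∣ C ∣ ≤ m → ∀ j →
                Σ Colour λ a → lookup C (vertex j a) ≡ false × (nonzero a ≡ true → lookup C (vertex j zero) ≡ true)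
  free-colour C small j with lookup C (vertex j zero) in c₀
  ... | false = zero , c₀ , λ ()
  ... | true with Finᵖ.all? (λ a → lookup C (vertex j a) Bool.≟ true)
  ...   | no ¬full = let a , a∉C = Finᵖ.¬∀⟶∃¬ (suc m) _ (λ a → lookup C (vertex j a) Bool.≟ true) ¬full
                     in a , ¬-not a∉C , λ _ → refl
  ...   | yes full = ⊥-elim (1+n≰n (begin
    suc m                                                 ≡⟨ sym (count-all full) ⟩
    count (λ a → lookup C (vertex j a))                   ≤⟨ term≤∑ (λ i → count (λ a → lookup C (vertex i a))) j ⟩
    ∑[ i < r ] count (λ a → lookup C (vertex i a))        ≡⟨ sym (trans (∣∣≡count C) (count-vertices (lookup C))) ⟩
    ∣ C ∣                                                 ≤⟨ small ⟩
    m                                                     ∎))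
    where open ≤-Reasoning

  avoiding-colouring : ∀ C → ∣ C ∣ ≤ m → Σ Colouring λ g → support g ≤ m × Disjoint C (graph g)
  avoiding-colouring C small = g , small-support , avoids
    where
    free : ∀ j → Σ Colour λ a → lookup C (vertex j a) ≡ false × (nonzero a ≡ true → lookup C (vertex j zero) ≡ true)
    free = free-colour C small
    g : Colouring
    g = tabulate (proj₁ ∘ free)
    colour-0-in-C : ∀ j → nonzero (lookup g j) ≡ true → lookup C (vertex j zero) ≡ true
    colour-0-in-C j nz = proj₂ (proj₂ (free j)) (trans (cong nonzero (sym (lookup∘tabulate _ j))) nz)
    small-support : support g ≤ m
    small-support = begin
      support g                                      ≤⟨ ∑-mono (λ j → 𝟙-mono (colour-0-in-C j)) ⟩
      ∑[ j < r ] 𝟙 (lookup C (vertex j zero))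
        ≤⟨ ∑-mono (λ j → term≤∑ (λ a → 𝟙 (lookup C (vertex j a))) zero) ⟩
      ∑[ j < r ] count (λ a → lookup C (vertex j a)) ≡⟨ sym (trans (∣∣≡count C) (count-vertices (lookup C))) ⟩
      ∣ C ∣                                          ≤⟨ small ⟩
      m                                              ∎
      where open ≤-Reasoning
    avoids : Disjoint C (graph g)
    avoids v v∈C v∈g =
      true≢false (trans (sym v∈C) (trans (cong (lookup C) (sym same-vertex)) (proj₁ (proj₂ (free (part v))))))
      where
      same-vertex : vertex (part v) (proj₁ (free (part v))) ≡ v
      same-vertex = trans (cong (vertex (part v)) (trans (sym (lookup∘tabulate _ (part v))) (on-graph g v v∈g)))
                          (vertex-part-colour v)

  cover-lower-bound : ∀ C → IsCover H₀ C → m + 1 ≤ ∣ C ∣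
  cover-lower-bound C covers = ≮⇒≥ too-small
    where
    too-small : ∣ C ∣ < m + 1 → ⊥
    too-small C<m+1 with avoiding-colouring C (≤-pred (subst (suc ∣ C ∣ ≤_) (+-comm m 1) C<m+1))
    ... | g , small , avoids with covers (graph g) (graph-edge g small)
    ...   | v , v∈C∩g = avoids v (∧-conicalˡ _ _ both) (∧-conicalʳ (lookup C v) _ both)
      where both = trans (sym (lookup-∩ C (graph g) v)) ([]=⇒lookup v∈C∩g)

  extremal : (∀ H → Uniform r H → Partite r H → KWiseIntersecting k t H → CoverNumber≤ H (m + 1)) →
             Σ Hypergraph λ H → Uniform r H × Partite r H × KWiseIntersecting k t H × CoverNumber≡ H (m + 1)
  extremal upper with upper H₀ uniform partite kwise
  ... | C , covers , small =
        H₀ , uniform , partite , kwise , (C , covers , ≤-antisym small (cover-lower-bound C covers)) , cover-lower-bound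

upper-bound : ∀ r k t .{{_ : NonZero k}} → 1 ≤ t → t ≤ r → ((3 ≤ k × 1 ≤ t) ⊎ (k ≡ 2 × r < 3 * t)) →
              (H : Hypergraph) → Partite r H → KWiseIntersecting k t H → CoverNumber≤ H ((r ∸ t) / k + 1)
upper-bound r (suc (suc (suc q))) t 1≤t t≤r _ H (part , partite) kwise =
  PartiteHypergraph.upper-bound-many H part partite q t 1≤t t≤r kwise
upper-bound r 2 t _ t≤r (inj₂ (_ , r<3t)) H (part , partite) pairwise =
  PartiteHypergraph.upper-bound-pairs H part partite t t≤r r<3t pairwise
upper-bound r 2 t _ _ (inj₁ (s≤s (s≤s ()) , _))
upper-bound r 1 t _ _ (inj₁ (s≤s () , _))
upper-bound r 1 t _ _ (inj₂ (() , _))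
upper-bound r 0 t _ _ (inj₁ (() , _))
upper-bound r 0 t _ _ (inj₂ (() , _))

theorem1p7 : (r k t : ℕ) → 1 ≤ r → .{{_ : NonZero k}} → 1 ≤ t → t ≤ r →
    ((3 ≤ k × 1 ≤ t) ⊎ (k ≡ 2 × r < 3 * t)) →
    ((H : Hypergraph) → Uniform r H → Partite r H → KWiseIntersecting k t H →
       CoverNumber≤ H ((r ∸ t) / k + 1))
    × (Σ Hypergraph λ H → Uniform r H × Partite r H × KWiseIntersecting k t H
         × CoverNumber≡ H ((r ∸ t) / k + 1))
theorem1p7 r k t _ 1≤t t≤r regime = upper , Construction.extremal r t k t≤r upper
  where
  upper : (H : Hypergraph) → Uniform r H → Partite r H → KWiseIntersecting k t H →
          CoverNumber≤ H ((r ∸ t) / k + 1)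
  upper H _ = upper-bound r k t 1≤t t≤r regime H
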